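{- Let $G$ be a connected graph of order $n\ge 3$ and $q$ an integer with $2\le q\le n-1$. Every $H\in\mathcal{S}_q(G)$ has at least $3$ components. Moreover, if $H\in\mathcal{M}_q(G)$, then: (i) each component of $H$ is a vertex-induced subgraph of $G$; (ii) if in addition $or_1(H)\ge or_1(H')$ for every $H'\in\mathcal{M}_q(G)$, then either $or_1(H)+or_3(H)=q$, or $|N_G(u)\cap V(H_2)|>|N_G(u)\cap V(H_1)|$ for every $u\in V(H_2)$, where $H_1,H_2$ are components of $H$ with $|V(H_i)|=or_i(H)$ for $i=1,2$.
   Context: For a graph $H$ with components $H_1,\dots,H_s$ ordered so that $|V(H_1)|\ge\dots\ge|V(H_s)|$, write $or_i(H)=|V(H_i)|$. $\mathcal{S}_q(G)$ is the set of disconnected spanning subgraphs $H$ of $G$ with $or_1(H)+or_2(H)\le q$; $\ell_q(G)$ is the maximum number of edges of a member of $\mathcal{S}_q(G)$, and $\mathcal{M}_q(G)$ is the set of members of $\mathcal{S}_q(G)$ with exactly $\ell_q(G)$ edges. $N_G(u)$ is the neighborhood of $u$ in $G$. -}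

module Defs where

open import Data.Nat using (ℕ; zero; suc; _+_; _≤_; _<_; _<ᵇ_)
open import Data.Bool using (Bool; true; false; _∧_; if_then_else_)
open import Data.Fin using (Fin; toℕ)
import Data.Fin as F
open import Data.Fin.Subset using (Subset; _∈_; _∩_; ∣_∣)
open import Data.List using (List; map; allFin)
open import Data.Nat.ListAction using (sum)
open import Data.Vec using (tabulate)
open import Data.Product using (Σ; _×_; ∃; ∃-syntax; _,_)
open import Relation.Nullary using (¬_)
open import Relation.Binary.PropositionalEquality using (_≡_)
open import Function.Bundles using (_⇔_)

record Graph (n : ℕ) : Set where
  field
    adj    : Fin n → Fin n → Bool
    sym    : ∀ u v → adj u v ≡ adj v u
    irrefl : ∀ u → adj u u ≡ false
open Graph public

data Walk {n : ℕ} (G : Graph n) : Fin n → Fin n → Set where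
  here : ∀ {u} → Walk G u u
  step : ∀ {u w v} → adj G u w ≡ true → Walk G w v → Walk G u v

Connected : ∀ {n} → Graph n → Set
Connected G = ∀ u v → Walk G u v

edges : ∀ {n} → Graph n → ℕ
edges {n} G = sum (map (λ u → sum (map (λ v →
  if (toℕ u <ᵇ toℕ v) ∧ adj G u v then 1 else 0) (allFin n))) (allFin n))

SpanningSubgraph : ∀ {n} → Graph n → Graph n → Set
SpanningSubgraph {n} G H = ∀ (u v : Fin n) → adj H u v ≡ true → adj G u v ≡ true

IsComponent : ∀ {n} → Graph n → Subset n → Set
IsComponent {n} H C = Σ (Fin n) λ v → ∀ (u : Fin n) → (u ∈ C) ⇔ Walk H v u

record CompOrder {n : ℕ} (H : Graph n) : Set where
  field
    s        : ℕ
    comp     : Fin s → Subset n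
    isComp   : ∀ i → IsComponent H (comp i)
    distinct : ∀ i j → comp i ≡ comp j → i ≡ j
    complete : ∀ C → IsComponent H C → ∃[ i ] comp i ≡ C
    sorted   : ∀ (i j : Fin s) → toℕ i ≤ toℕ j → ∣ comp j ∣ ≤ ∣ comp i ∣
open CompOrder public

-- or_i(H) (1-based), with the convention or_i = 0 when i is out of range.
lookupSize : ∀ {n} (m : ℕ) → (Fin m → Subset n) → ℕ → ℕ
lookupSize zero    f k             = 0
lookupSize (suc m) f zero          = ∣ f F.zero ∣
lookupSize (suc m) f (suc k)       = lookupSize m (λ i → f (F.suc i)) k

or : ∀ {n} {H : Graph n} → CompOrder H → ℕ → ℕ
or O zero    = 0
or O (suc i) = lookupSize (s O) (comp O) i

-- H ∈ S_q(G).  (or_i does not depend on the chosen ordering of the components.)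
InS : ∀ {n} → ℕ → Graph n → Graph n → Set
InS q G H = SpanningSubgraph G H × ¬ Connected H
          × (∀ (O : CompOrder H) → or O 1 + or O 2 ≤ q)

InM : ∀ {n} → ℕ → Graph n → Graph n → Set
InM {n} q G H = InS q G H × (∀ (H' : Graph n) → InS q G H' → edges H' ≤ edges H)

N : ∀ {n} → Graph n → Fin n → Subset n
N G u = tabulate λ v → adj G u v

-- If H ∈ S_q had only two components, they would cover all n vertices although
-- or₁ + or₂ ≤ q < n. If H ∈ M_q missed an edge of G inside one of its components,
-- adding that edge would change no component and so keep H in S_q with one more edge.
-- For (ii), suppose or₁ + or₃ < q and some u ∈ H₂ has at least as many G-neighbours
-- in H₁ as in H₂. Cut u off and join it to its G-neighbours in H₁: no edge is lost,
-- the new largest component H₁ + u has at most or₁ + 1 vertices, and every other new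
-- component lies in H₂ − u or in an old component of order at most or₃. The new graph
-- is therefore again in M_q, with a larger largest component. If u has no G-neighbour
-- in H₁ at all, u is isolated, every component except H₁ is a single vertex, and the
-- same move applies to any vertex adjacent in G to H₁.

module Submission where

open import Defs hiding (sym)

open import Data.Bool using (Bool; true; false; _∧_; _∨_; if_then_else_)
import Data.Bool.Properties as Bool
open import Data.Empty using (⊥; ⊥-elim)
open import Data.Fin using (Fin; zero; suc; toℕ; fromℕ<)
open import Data.Fin.Properties
  using (punchInᵢ≢i; toℕ-injective; any?; all?; ¬∀⟶∃¬; toℕ<n; toℕ-fromℕ<) renaming (_≟_ to _≟ᶠ_)
open import Data.Fin.Subset using (Subset; _∈_; _∉_; _⊆_; _⊂_; _∩_; _∪_; _-_; _─_; ⁅_⁆; ⊤; ∣_∣; inside; outside)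
open import Data.Fin.Subset.Properties
open import Data.List using (List; map; allFin; length; deduplicate)
import Data.List as List
open import Data.List.Membership.Propositional using () renaming (_∈_ to _∈ˡ_)
open import Data.List.Membership.Propositional.Properties
  using (∈-map⁺; ∈-map⁻; ∈-allFin; ∈-deduplicate⁺; ∈-deduplicate⁻; ∈-lookup)
open import Data.List.Properties using (map-tabulate; map-cong)
open import Data.List.Relation.Binary.Permutation.Propositional using (↭-sym; ↭⇒↭ₛ)
open import Data.List.Relation.Binary.Permutation.Propositional.Properties using (∈-resp-↭)
open import Data.List.Relation.Binary.Permutation.Setoid.Properties using (Unique-resp-↭)
open import Data.List.Relation.Unary.All using () renaming (lookup to lookupᴬ)
open import Data.List.Relation.Unary.AllPairs using (_∷_)
import Data.List.Relation.Unary.Any as Any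
open import Data.List.Relation.Unary.Any.Properties using (lookup-index)
open import Data.List.Relation.Unary.Sorted.TotalOrder.Properties using (lookup-mono-≤)
open import Data.List.Relation.Unary.Unique.DecPropositional.Properties using (deduplicate-!)
open import Data.List.Relation.Unary.Unique.Propositional using (Unique)
import Data.List.Sort as Sort
open import Data.Nat using (ℕ; zero; suc; _+_; _≤_; _<_; _∸_; _<ᵇ_; _<?_; z≤n; s≤s)
open import Data.Nat.ListAction using (sum)
open import Data.Nat.Properties
open import Algebra.Properties.CommutativeMonoid.Sum +-0-commutativeMonoid
  using (sum-remove; sum-cong-≗; ∑-distrib-+) renaming (sum to ∑)
open import Data.Nat.Tactic.RingSolver using (solve-∀)
open import Data.Product using (Σ; _×_; ∃-syntax; _,_; proj₁; proj₂)
open import Data.Sum using (_⊎_; inj₁; inj₂)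
open import Data.Vec using ([]; _∷_; tabulate; here; there)
open import Data.Vec.Functional using (removeAt)
open import Data.Vec.Properties using (lookup∘tabulate; []=⇒lookup; lookup⇒[]=; ≡-dec)
open import Function using (_∘_)
open import Function.Bundles using (mk⇔; Equivalence)
open import Relation.Binary.Bundles using (DecTotalOrder)
import Relation.Binary.Construct.Flip.Ord as Flip
import Relation.Binary.Construct.On as On
open import Relation.Binary.Definitions using (tri<; tri≈; tri>)
open import Relation.Binary.PropositionalEquality
open import Relation.Nullary using (¬_; Dec; yes; no; does; ¬?; contradiction)
open import Relation.Nullary.Decidable using (dec-true; dec-false; does-⇔; map′; _×-dec_; _⊎-dec_)
open import Relation.Unary using (Decidable)

private variable
  n : ℕ

-- Finite sums and subsets

sum-allFin : (f : Fin n → ℕ) → sum (map f (allFin n)) ≡ ∑ f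
sum-allFin {n} f = trans (cong sum (map-tabulate (λ i → i) f)) (go f)
  where
  go : ∀ {m} (g : Fin m → ℕ) → sum (List.tabulate g) ≡ ∑ g
  go {zero} g = refl
  go {suc m} g = cong (g zero +_) (go (λ i → g (suc i)))

∑-exchange : (f g : Fin n → ℕ) (x : Fin n) → (∀ a → a ≢ x → f a ≡ g a) →
  ∑ f + g x ≡ ∑ g + f x
∑-exchange {suc n} f g x f≡g = begin
  ∑ f + g x                     ≡⟨ cong (_+ g x) (sum-remove f) ⟩
  f x + ∑ (removeAt f x) + g x  ≡⟨ cong (λ s → f x + s + g x) (sum-cong-≗ (λ i → f≡g _ (punchInᵢ≢i x i))) ⟩
  f x + ∑ (removeAt g x) + g x  ≡⟨ +-comm (f x + _) (g x) ⟩
  g x + (f x + ∑ (removeAt g x)) ≡⟨ cong (g x +_) (+-comm (f x) _) ⟩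
  g x + (∑ (removeAt g x) + f x) ≡⟨ +-assoc (g x) _ (f x) ⟨
  g x + ∑ (removeAt g x) + f x  ≡⟨ cong (_+ f x) (sum-remove g) ⟨
  ∑ g + f x                     ∎
  where open ≡-Reasoning

∈-tabulate⁺ : {f : Fin n → Bool} {x : Fin n} → f x ≡ true → x ∈ tabulate f
∈-tabulate⁺ {f = f} {x} fx = lookup⇒[]= x (tabulate f) (trans (lookup∘tabulate f x) fx)

∈-tabulate⁻ : {f : Fin n → Bool} {x : Fin n} → x ∈ tabulate f → f x ≡ true
∈-tabulate⁻ {f = f} {x} x∈ = trans (sym (lookup∘tabulate f x)) ([]=⇒lookup x∈)

∣tabulate∣ : (f : Fin n → Bool) → ∣ tabulate f ∣ ≡ ∑ (λ i → if f i then 1 else 0)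
∣tabulate∣ {zero} f = refl
∣tabulate∣ {suc n} f with f zero
... | true  = cong suc (∣tabulate∣ (λ i → f (suc i)))
... | false = ∣tabulate∣ (λ i → f (suc i))

∣p∪q∣≤∣p∣+∣q∣ : (p q : Subset n) → ∣ p ∪ q ∣ ≤ ∣ p ∣ + ∣ q ∣
∣p∪q∣≤∣p∣+∣q∣ [] [] = z≤n
∣p∪q∣≤∣p∣+∣q∣ (inside ∷ p) (t ∷ q) = s≤s (≤-trans (∣p∪q∣≤∣p∣+∣q∣ p q) (+-monoʳ-≤ ∣ p ∣ (∣p∣≤∣x∷p∣ t q)))
∣p∪q∣≤∣p∣+∣q∣ (outside ∷ p) (inside ∷ q) = ≤-trans (s≤s (∣p∪q∣≤∣p∣+∣q∣ p q)) (≤-reflexive (sym (+-suc ∣ p ∣ ∣ q ∣)))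
∣p∪q∣≤∣p∣+∣q∣ (outside ∷ p) (outside ∷ q) = ∣p∪q∣≤∣p∣+∣q∣ p q

x∈p-y⇒x≢y : {p : Subset n} {x y : Fin n} → x ∈ p - y → x ≢ y
x∈p-y⇒x≢y {p = p} {x} {y} x∈ refl = go p ⁅ x ⁆ (x∈⁅x⁆ x) x∈
  where
  go : ∀ {m} {z : Fin m} (p q : Subset m) → z ∈ q → z ∉ p ─ q
  go (_ ∷ p) (inside ∷ q) here ()
  go (_ ∷ p) (_ ∷ q) (there z∈q) (there z∈) = go p q z∈q z∈

does⇒ : ∀ {A : Set} (a? : Dec A) → does a? ≡ true → A
does⇒ (yes a) _ = a

select : {P : Fin n → Set} → Decidable P → Subset n
select P? = tabulate (λ x → does (P? x))

∈-select⁺ : {P : Fin n → Set} (P? : Decidable P) {x : Fin n} → P x → x ∈ select P?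
∈-select⁺ P? {x} px = ∈-tabulate⁺ (dec-true (P? x) px)

∈-select⁻ : {P : Fin n → Set} (P? : Decidable P) {x : Fin n} → x ∈ select P? → P x
∈-select⁻ P? {x} x∈ = does⇒ (P? x) (∈-tabulate⁻ x∈)

lookup-injective : ∀ {A : Set} {xs : List A} → Unique xs →
  ∀ i j → List.lookup xs i ≡ List.lookup xs j → i ≡ j
lookup-injective (_ ∷ _) zero zero _ = refl
lookup-injective (x∉ ∷ _) zero (suc j) eq = contradiction eq (lookupᴬ x∉ (∈-lookup j))
lookup-injective (x∉ ∷ _) (suc i) zero eq = contradiction (sym eq) (lookupᴬ x∉ (∈-lookup i))
lookup-injective (_ ∷ u) (suc i) (suc j) eq = cong suc (lookup-injective u i j eq)

x∈p⇒1≤∣p∣ : {p : Subset n} {x : Fin n} → x ∈ p → 1 ≤ ∣ p ∣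
x∈p⇒1≤∣p∣ {x = x} x∈p = subst (_≤ _) (∣⁅x⁆∣≡1 x) (p⊆q⇒∣p∣≤∣q∣ λ y∈ → subst (_∈ _) (sym (x∈⁅y⁆⇒x≡y x y∈)) x∈p)

∣p∣<n⇒∃∉ : (p : Subset n) → ∣ p ∣ < n → ∃[ x ] x ∉ p
∣p∣<n⇒∃∉ {n} p ∣p∣<n with any? (λ x → ¬? (x ∈? p))
... | yes x∉p = x∉p
... | no ¬∃ = contradiction (subst (_≤ ∣ p ∣) (∣⊤∣≡n n) (p⊆q⇒∣p∣≤∣q∣ ⊤⊆p)) (<⇒≱ ∣p∣<n)
  where
  ⊤⊆p : ⊤ ⊆ p
  ⊤⊆p {x} _ with x ∈? p
  ... | yes x∈p = x∈p
  ... | no x∉p = contradiction (x , x∉p) ¬∃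

-- Walks and components

∈N⁺ : ∀ {n} (K : Graph n) {u v} → adj K u v ≡ true → v ∈ N K u
∈N⁺ K = ∈-tabulate⁺

∈N⁻ : ∀ {n} (K : Graph n) {u v} → v ∈ N K u → adj K u v ≡ true
∈N⁻ K = ∈-tabulate⁻

module _ {n : ℕ} (H : Graph n) where

  Closed : Subset n → Set
  Closed S = ∀ {x y} → x ∈ S → adj H x y ≡ true → y ∈ S

  walk-snoc : ∀ {u w v} → Walk H u w → adj H w v ≡ true → Walk H u v
  walk-snoc here e = step e here
  walk-snoc (step e p) e′ = step e (walk-snoc p e′)

  walk-++ : ∀ {u v w} → Walk H u v → Walk H v w → Walk H u w
  walk-++ here q = q
  walk-++ (step e p) q = step e (walk-++ p q)

  walk-reverse : ∀ {u v} → Walk H u v → Walk H v u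
  walk-reverse here = here
  walk-reverse (step {u} {w} e p) = walk-snoc (walk-reverse p) (trans (Graph.sym H w u) e)

  walk-closed : ∀ {S u v} → Closed S → u ∈ S → Walk H u v → v ∈ S
  walk-closed cl u∈S here = u∈S
  walk-closed cl u∈S (step e p) = walk-closed cl (cl u∈S e) p

  walk-exit : ∀ {S u v} → u ∈ S → v ∉ S → Walk H u v →
    ∃[ y ] ∃[ z ] y ∈ S × z ∉ S × adj H y z ≡ true
  walk-exit u∈S v∉S here = contradiction u∈S v∉S
  walk-exit {S} {u} u∈S v∉S (step {w = w} e p) with w ∈? S
  ... | yes w∈S = walk-exit w∈S v∉S p
  ... | no w∉S = u , w , u∈S , w∉S , e

walk-map : ∀ {n} {H H′ : Graph n} → (∀ {y z} → adj H y z ≡ true → Walk H′ y z) →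
  ∀ {u v} → Walk H u v → Walk H′ u v
walk-map tr here = here
walk-map {H′ = H′} tr (step e p) = walk-++ H′ (tr e) (walk-map tr p)

walk-restrict : ∀ {n} {H H′ : Graph n} {S : Subset n} → Closed H S →
  (∀ {y z} → y ∈ S → adj H y z ≡ true → adj H′ y z ≡ true) →
  ∀ {u v} → u ∈ S → Walk H u v → Walk H′ u v
walk-restrict cl tr u∈S here = here
walk-restrict cl tr u∈S (step e p) = step (tr u∈S e) (walk-restrict cl tr (cl u∈S e) p)

module _ {n : ℕ} {H : Graph n} where

  root∈component : ∀ {C} (c : IsComponent H C) → proj₁ c ∈ C
  root∈component (r , c) = Equivalence.from (c r) here

  component-walk : ∀ {C x y} → IsComponent H C → x ∈ C → y ∈ C → Walk H x y
  component-walk (r , c) x∈C y∈C =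
    walk-++ H (walk-reverse H (Equivalence.to (c _) x∈C)) (Equivalence.to (c _) y∈C)

  component-closed : ∀ {C} → IsComponent H C → Closed H C
  component-closed (r , c) x∈C e = Equivalence.from (c _) (walk-snoc H (Equivalence.to (c _) x∈C) e)

  component-⊆ : ∀ {C S x} → IsComponent H C → Closed H S → x ∈ C → x ∈ S → C ⊆ S
  component-⊆ c cl x∈C x∈S y∈C = walk-closed H cl x∈S (component-walk c x∈C y∈C)

  components-≡ : ∀ {C C′ x} → IsComponent H C → IsComponent H C′ → x ∈ C → x ∈ C′ → C ≡ C′
  components-≡ c c′ x∈C x∈C′ =
    ⊆-antisym (component-⊆ c (component-closed c′) x∈C x∈C′) (component-⊆ c′ (component-closed c) x∈C′ x∈C)

  components-disjoint : ∀ {C C′ x} → IsComponent H C → IsComponent H C′ → C ≢ C′ → x ∈ C → x ∉ C′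
  components-disjoint c c′ C≢C′ x∈C x∈C′ = C≢C′ (components-≡ c c′ x∈C x∈C′)

  component-nonempty : ∀ {C} → IsComponent H C → 1 ≤ ∣ C ∣
  component-nonempty c = x∈p⇒1≤∣p∣ (root∈component c)

  degree<component : ∀ {C x} → IsComponent H C → x ∈ C → ∣ N H x ∣ < ∣ C ∣
  degree<component {C} {x} c x∈C = ≤-<-trans (p⊆q⇒∣p∣≤∣q∣ N⊆C-x) (x∈p⇒∣p-x∣<∣p∣ x∈C)
    where
    N⊆C-x : N H x ⊆ C - x
    N⊆C-x b∈N = x∈p∧x≢y⇒x∈p-y (component-closed c x∈C (∈N⁻ H b∈N))
      (λ { refl → contradiction (trans (sym (∈N⁻ H b∈N)) (Graph.irrefl H x)) λ () })

  isolated-component : ∀ {C u} → ∣ N H u ∣ ≡ 0 → IsComponent H C → u ∈ C → ∣ C ∣ ≤ 1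
  isolated-component {C} {u} ∣N∣≡0 c u∈C =
    subst (∣ C ∣ ≤_) (∣⁅x⁆∣≡1 u) (p⊆q⇒∣p∣≤∣q∣ λ w∈C → stays (component-walk c u∈C w∈C))
    where
    stays : ∀ {w} → Walk H u w → w ∈ ⁅ u ⁆
    stays here = x∈⁅x⁆ u
    stays (step e _) = contradiction (subst (1 ≤_) ∣N∣≡0 (x∈p⇒1≤∣p∣ (∈N⁺ H e))) λ ()

module Reachability {n : ℕ} (H : Graph n) where

  Entered : Subset n → Fin n → Set
  Entered S w = ∃[ y ] y ∈ S × adj H y w ≡ true

  entered? : ∀ S → Decidable (Entered S)
  entered? S w = any? (λ y → (y ∈? S) ×-dec (adj H y w Bool.≟ true))

  grow : Subset n → Subset n
  grow S = S ∪ select (entered? S)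

  reachWithin : Fin n → ℕ → Subset n
  reachWithin v zero = ⁅ v ⁆
  reachWithin v (suc k) = grow (reachWithin v k)

  ∈-grow⁻ : ∀ {S w} → w ∈ grow S → w ∈ S ⊎ Entered S w
  ∈-grow⁻ {S} w∈ with x∈p∪q⁻ S _ w∈
  ... | inj₁ w∈S = inj₁ w∈S
  ... | inj₂ w∈E = inj₂ (∈-select⁻ (entered? S) w∈E)

  grow-closed : ∀ {S} → Closed H S → grow S ≡ S
  grow-closed {S} cl = ⊆-antisym grow⊆S (p⊆p∪q _)
    where
    grow⊆S : grow S ⊆ S
    grow⊆S w∈ with ∈-grow⁻ w∈
    ... | inj₁ w∈S = w∈S
    ... | inj₂ (y , y∈S , e) = cl y∈S e

  ¬⊂grow⇒closed : ∀ {S} → ¬ (S ⊂ grow S) → Closed H S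
  ¬⊂grow⇒closed {S} ¬⊂ {x} {y} x∈S e with y ∈? S
  ... | yes y∈S = y∈S
  ... | no y∉S = contradiction S⊂grow ¬⊂
    where
    S⊂grow : S ⊂ grow S
    S⊂grow = p⊆p∪q _ , y , x∈p∪q⁺ (inj₂ (∈-select⁺ (entered? S) (x , x∈S , e))) , y∉S

  closed-or-large : ∀ v k → Closed H (reachWithin v k) ⊎ k < ∣ reachWithin v k ∣
  closed-or-large v zero = inj₂ (x∈p⇒1≤∣p∣ (x∈⁅x⁆ v))
  closed-or-large v (suc k) with closed-or-large v k
  ... | inj₁ cl = inj₁ (subst (Closed H) (sym (grow-closed cl)) cl)
  ... | inj₂ large with reachWithin v k ⊂? grow (reachWithin v k)
  ...   | yes ⊂grow = inj₂ (<-≤-trans (s≤s large) (p⊂q⇒∣p∣<∣q∣ ⊂grow))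
  ...   | no ¬⊂grow = inj₁ (subst (Closed H) (sym (grow-closed cl)) cl)
    where cl = ¬⊂grow⇒closed ¬⊂grow

  reach : Fin n → Subset n
  reach v = reachWithin v n

  reach-closed : ∀ v → Closed H (reach v)
  reach-closed v with closed-or-large v n
  ... | inj₁ cl = cl
  ... | inj₂ large = contradiction (∣p∣≤n (reach v)) (<⇒≱ large)

  ∈reachWithin : ∀ v k → v ∈ reachWithin v k
  ∈reachWithin v zero = x∈⁅x⁆ v
  ∈reachWithin v (suc k) = p⊆p∪q _ (∈reachWithin v k)

  reachWithin-sound : ∀ v k {w} → w ∈ reachWithin v k → Walk H v w
  reachWithin-sound v zero w∈ rewrite x∈⁅y⁆⇒x≡y v w∈ = here
  reachWithin-sound v (suc k) w∈ with ∈-grow⁻ w∈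
  ... | inj₁ w∈R = reachWithin-sound v k w∈R
  ... | inj₂ (y , y∈R , e) = walk-snoc H (reachWithin-sound v k y∈R) e

  reach-sound : ∀ {v w} → w ∈ reach v → Walk H v w
  reach-sound = reachWithin-sound _ n

  reach-complete : ∀ {v w} → Walk H v w → w ∈ reach v
  reach-complete = walk-closed H (reach-closed _) (∈reachWithin _ n)

  reach-isComponent : ∀ v → IsComponent H (reach v)
  reach-isComponent v = v , λ w → mk⇔ reach-sound reach-complete

  walk? : ∀ u v → Dec (Walk H u v)
  walk? u v = map′ reach-sound reach-complete (v ∈? reach u)

module ComponentOrder {n : ℕ} (H : Graph n) where
  open Reachability H

  bySizeDescending : DecTotalOrder _ _ _
  bySizeDescending = On.decTotalOrder (Flip.decTotalOrder ≤-decTotalOrder) (∣_∣ {n})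

  open Sort bySizeDescending using (sort; sort-↭; sort-↗)

  reachSets : List (Subset n)
  reachSets = deduplicate (≡-dec Bool._≟_) (map reach (allFin n))

  componentList : List (Subset n)
  componentList = sort reachSets

  componentList-unique : Unique componentList
  componentList-unique = Unique-resp-↭ (setoid _) (↭⇒↭ₛ (↭-sym (sort-↭ reachSets))) (deduplicate-! _ _)

  componentList-isComponent : ∀ i → IsComponent H (List.lookup componentList i)
  componentList-isComponent i with ∈-map⁻ reach (∈-deduplicate⁻ _ _ (∈-resp-↭ (sort-↭ reachSets) (∈-lookup i)))
  ... | v , _ , eq = subst (IsComponent H) (sym eq) (reach-isComponent v)

  component∈componentList : ∀ {C} → IsComponent H C → C ∈ˡ componentList
  component∈componentList {C} c = subst (_∈ˡ componentList) (sym C≡reach) reach∈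
    where
    r = proj₁ c
    C≡reach : C ≡ reach r
    C≡reach = components-≡ c (reach-isComponent r) (root∈component c) (reach-complete here)
    reach∈ : reach r ∈ˡ componentList
    reach∈ = ∈-resp-↭ (↭-sym (sort-↭ reachSets)) (∈-deduplicate⁺ (≡-dec Bool._≟_) (∈-map⁺ reach (∈-allFin r)))

  componentOrder : CompOrder H
  componentOrder = record
    { s        = length componentList
    ; comp     = List.lookup componentList
    ; isComp   = componentList-isComponent
    ; distinct = lookup-injective componentList-unique
    ; complete = λ C c → let mem = component∈componentList c in Any.index mem , sym (lookup-index mem)
    ; sorted   = λ i j i≤j → lookup-mono-≤ (DecTotalOrder.totalOrder bySizeDescending) (sort-↗ reachSets) i≤j
    }

lookupSize-toℕ : ∀ {n} m (f : Fin m → Subset n) i → lookupSize m f (toℕ i) ≡ ∣ f i ∣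
lookupSize-toℕ (suc m) f zero = refl
lookupSize-toℕ (suc m) f (suc i) = lookupSize-toℕ m (λ j → f (suc j)) i

lookupSize-antitone : ∀ {n} m (f : Fin m → Subset n) → (∀ i j → toℕ i ≤ toℕ j → ∣ f j ∣ ≤ ∣ f i ∣) →
  ∀ k → lookupSize m f (suc k) ≤ lookupSize m f k
lookupSize-antitone zero f sorted k = z≤n
lookupSize-antitone (suc zero) f sorted zero = z≤n
lookupSize-antitone (suc (suc m)) f sorted zero = sorted zero (suc zero) z≤n
lookupSize-antitone (suc m) f sorted (suc k) =
  lookupSize-antitone m (λ i → f (suc i)) (λ i j i≤j → sorted (suc i) (suc j) (s≤s i≤j)) k

index-≥1 : ∀ {m} {i j : Fin m} → i ≢ j → 1 ≤ toℕ i ⊎ 1 ≤ toℕ j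
index-≥1 {i = suc _} _ = inj₁ (s≤s z≤n)
index-≥1 {j = suc _} _ = inj₂ (s≤s z≤n)
index-≥1 {i = zero} {zero} i≢j = contradiction refl i≢j

index-≥2 : ∀ {m} {i j k : Fin m} → i ≢ j → i ≢ k → j ≢ k → 2 ≤ toℕ i ⊎ 2 ≤ toℕ j ⊎ 2 ≤ toℕ k
index-≥2 {i = suc (suc _)} _ _ _ = inj₁ (s≤s (s≤s z≤n))
index-≥2 {j = suc (suc _)} _ _ _ = inj₂ (inj₁ (s≤s (s≤s z≤n)))
index-≥2 {k = suc (suc _)} _ _ _ = inj₂ (inj₂ (s≤s (s≤s z≤n)))
index-≥2 {i = zero}     {zero}         i≢j _ _ = contradiction refl i≢j
index-≥2 {i = suc zero} {suc zero}     i≢j _ _ = contradiction refl i≢j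
index-≥2 {i = zero}     {k = zero}     _ i≢k _ = contradiction refl i≢k
index-≥2 {i = suc zero} {k = suc zero} _ i≢k _ = contradiction refl i≢k
index-≥2 {j = zero}     {k = zero}     _ _ j≢k = contradiction refl j≢k
index-≥2 {j = suc zero} {k = suc zero} _ _ j≢k = contradiction refl j≢k

module _ {n : ℕ} {H : Graph n} (O : CompOrder H) where

  index : ∀ {C} → IsComponent H C → Fin (s O)
  index c = proj₁ (complete O _ c)

  comp-index : ∀ {C} (c : IsComponent H C) → comp O (index c) ≡ C
  comp-index c = proj₂ (complete O _ c)

  index-distinct : ∀ {C C′} (c : IsComponent H C) (c′ : IsComponent H C′) → C ≢ C′ → index c ≢ index c′
  index-distinct c c′ C≢C′ eq = C≢C′ (trans (sym (comp-index c)) (trans (cong (comp O) eq) (comp-index c′)))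

  component≤or : ∀ {C k} (c : IsComponent H C) → k ≤ toℕ (index c) → ∣ C ∣ ≤ or O (suc k)
  component≤or {C} {k} c k≤i = begin
    ∣ C ∣                     ≡⟨ cong ∣_∣ (comp-index c) ⟨
    ∣ comp O (index c) ∣      ≤⟨ sorted O j (index c) (≤-trans (≤-reflexive (toℕ-fromℕ< _)) k≤i) ⟩
    ∣ comp O j ∣              ≡⟨ lookupSize-toℕ (s O) (comp O) j ⟨
    lookupSize (s O) (comp O) (toℕ j) ≡⟨ cong (lookupSize (s O) (comp O)) (toℕ-fromℕ< _) ⟩
    or O (suc k)              ∎
    where
    open ≤-Reasoning
    j = fromℕ< (≤-<-trans k≤i (toℕ<n (index c)))

  component≤or₁ : ∀ {C} → IsComponent H C → ∣ C ∣ ≤ or O 1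
  component≤or₁ c = component≤or c z≤n

  or₃≤or₂ : or O 3 ≤ or O 2
  or₃≤or₂ = lookupSize-antitone (s O) (comp O) (sorted O) 1

  component≤or₂ : ∀ {C C′} (c : IsComponent H C) (c′ : IsComponent H C′) → C ≢ C′ →
    ∣ C ∣ ≤ ∣ C′ ∣ → ∣ C ∣ ≤ or O 2
  component≤or₂ c c′ C≢C′ C≤C′ with index-≥1 (index-distinct c c′ C≢C′)
  ... | inj₁ 1≤i = component≤or c 1≤i
  ... | inj₂ 1≤i′ = ≤-trans C≤C′ (component≤or c′ 1≤i′)

  component≤or₃ : ∀ {C C′ C″} (c : IsComponent H C) (c′ : IsComponent H C′) (c″ : IsComponent H C″) →
    C ≢ C′ → C ≢ C″ → C′ ≢ C″ → ∣ C ∣ ≤ ∣ C′ ∣ → ∣ C ∣ ≤ ∣ C″ ∣ → ∣ C ∣ ≤ or O 3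
  component≤or₃ c c′ c″ C≢C′ C≢C″ C′≢C″ C≤C′ C≤C″
    with index-≥2 (index-distinct c c′ C≢C′) (index-distinct c c″ C≢C″) (index-distinct c′ c″ C′≢C″)
  ... | inj₁ 2≤i = component≤or c 2≤i
  ... | inj₂ (inj₁ 2≤i′) = ≤-trans C≤C′ (component≤or c′ 2≤i′)
  ... | inj₂ (inj₂ 2≤i″) = ≤-trans C≤C″ (component≤or c″ 2≤i″)

  two-components≤or₁+or₂ : ∀ {C C′} (c : IsComponent H C) (c′ : IsComponent H C′) → C ≢ C′ →
    ∣ C ∣ + ∣ C′ ∣ ≤ or O 1 + or O 2
  two-components≤or₁+or₂ {C} {C′} c c′ C≢C′ with ≤-total ∣ C ∣ ∣ C′ ∣
  ... | inj₁ C≤C′ = ≤-trans (≤-reflexive (+-comm ∣ C ∣ ∣ C′ ∣))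
                      (+-mono-≤ (component≤or₁ c′) (component≤or₂ c c′ C≢C′ C≤C′))
  ... | inj₂ C′≤C = +-mono-≤ (component≤or₁ c) (component≤or₂ c′ c (λ eq → C≢C′ (sym eq)) C′≤C)

or₁+or₂≤-of-components : ∀ {n} {K : Graph n} {q} → (∀ {A} → IsComponent K A → ∣ A ∣ ≤ q) →
  (∀ {A B} → IsComponent K A → IsComponent K B → A ≢ B → ∣ A ∣ + ∣ B ∣ ≤ q) →
  (O : CompOrder K) → or O 1 + or O 2 ≤ q
or₁+or₂≤-of-components {n} {K} {q} single pair O = go (s O) (comp O) (isComp O) (distinct O)
  where
  go : ∀ m (f : Fin m → Subset n) → (∀ i → IsComponent K (f i)) → (∀ i j → f i ≡ f j → i ≡ j) →
    lookupSize m f 0 + lookupSize m f 1 ≤ q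
  go zero f _ _ = z≤n
  go (suc zero) f isC _ = ≤-trans (≤-reflexive (+-identityʳ _)) (single (isC zero))
  go (suc (suc m)) f isC dist = pair (isC zero) (isC (suc zero)) (λ eq → contradiction (dist _ _ eq) λ ())

-- Counting edges

module _ {n : ℕ} where

  oriented : Graph n → Fin n → Fin n → ℕ
  oriented K a b = if (toℕ a <ᵇ toℕ b) ∧ adj K a b then 1 else 0

  edges≡∑ : ∀ K → edges K ≡ ∑ (λ a → ∑ (oriented K a))
  edges≡∑ K = trans (cong sum (map-cong (λ a → sum-allFin (oriented K a)) (allFin n)))
                    (sum-allFin (λ a → ∑ (oriented K a)))

  oriented-diagonal : ∀ K x → oriented K x x ≡ 0
  oriented-diagonal K x rewrite dec-false (toℕ x <? toℕ x) (<-irrefl refl) = refl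

  adjacency-split : ∀ K a b → (if adj K a b then 1 else 0) ≡ oriented K a b + oriented K b a
  adjacency-split K a b with <-cmp (toℕ a) (toℕ b)
  ... | tri< a<b _ b≮a rewrite dec-true (toℕ a <? toℕ b) a<b | dec-false (toℕ b <? toℕ a) b≮a =
    sym (+-identityʳ _)
  ... | tri> a≮b _ b<a rewrite dec-false (toℕ a <? toℕ b) a≮b | dec-true (toℕ b <? toℕ a) b<a =
    cong (λ e → if e then 1 else 0) (Graph.sym K a b)
  ... | tri≈ _ a≡b _ rewrite toℕ-injective a≡b | oriented-diagonal K b | Graph.irrefl K b = refl

  degree-split : ∀ K x → ∣ N K x ∣ ≡ ∑ (oriented K x) + ∑ (λ a → oriented K a x)
  degree-split K x = begin
    ∣ N K x ∣                                   ≡⟨ ∣tabulate∣ (adj K x) ⟩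
    ∑ (λ b → if adj K x b then 1 else 0)        ≡⟨ sum-cong-≗ (adjacency-split K x) ⟩
    ∑ (λ b → oriented K x b + oriented K b x)   ≡⟨ ∑-distrib-+ (oriented K x) (λ b → oriented K b x) ⟩
    ∑ (oriented K x) + ∑ (λ a → oriented K a x) ∎
    where open ≡-Reasoning

  AgreeOff : Fin n → Graph n → Graph n → Set
  AgreeOff x K K′ = ∀ a b → a ≢ x → b ≢ x → adj K a b ≡ adj K′ a b

  -- Deleting x from K and from K′ leaves the same graph, so
  -- edges K − ∣ N K x ∣ = edges K′ − ∣ N K′ x ∣.
  edges-exchange : ∀ {K K′ x} → AgreeOff x K K′ → edges K + ∣ N K′ x ∣ ≡ edges K′ + ∣ N K x ∣
  edges-exchange {K} {K′} {x} agree = begin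
    edges K + ∣ N K′ x ∣                    ≡⟨ cong₂ _+_ (edges≡∑ K) (degree-split K′ x) ⟩
    E K + (R K′ x + ∑ (C K′))               ≡⟨ rearrange (E K) (R K′ x) (∑ (C K′)) ⟩
    E K + ∑ (C K′) + (R K′ x + 0)           ≡⟨ cong₂ _+_ (sym (∑-distrib-+ (R K) (C K′))) (cong (R K′ x +_) (sym (oriented-diagonal K x))) ⟩
    ∑ (mixed K K′) + mixed K′ K x           ≡⟨ ∑-exchange (mixed K K′) (mixed K′ K) x mixed-agree ⟩
    ∑ (mixed K′ K) + mixed K K′ x           ≡⟨ cong₂ _+_ (∑-distrib-+ (R K′) (C K)) (cong (R K x +_) (oriented-diagonal K′ x)) ⟩
    E K′ + ∑ (C K) + (R K x + 0)            ≡⟨ rearrange (E K′) (R K x) (∑ (C K)) ⟨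
    E K′ + (R K x + ∑ (C K))                ≡⟨ cong₂ _+_ (edges≡∑ K′) (degree-split K x) ⟨
    edges K′ + ∣ N K x ∣                    ∎
    where
    open ≡-Reasoning
    R : Graph n → Fin n → ℕ
    R L a = ∑ (oriented L a)
    C : Graph n → Fin n → ℕ
    C L a = oriented L a x
    E : Graph n → ℕ
    E L = ∑ (R L)
    mixed : Graph n → Graph n → Fin n → ℕ
    mixed L L′ a = R L a + C L′ a
    rearrange : ∀ e r c → e + (r + c) ≡ e + c + (r + 0)
    rearrange = solve-∀
    mixed-agree : ∀ a → a ≢ x → mixed K K′ a ≡ mixed K′ K a
    mixed-agree a a≢x = ∑-exchange (oriented K a) (oriented K′ a) x
      (λ b b≢x → cong (λ e → if (toℕ a <ᵇ toℕ b) ∧ e then 1 else 0) (agree a b a≢x b≢x))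

  edges-mono : ∀ {K K′ x} → AgreeOff x K K′ → ∣ N K x ∣ ≤ ∣ N K′ x ∣ → edges K ≤ edges K′
  edges-mono {K} {K′} {x} agree deg≤ = +-cancelʳ-≤ ∣ N K′ x ∣ _ _
    (≤-trans (≤-reflexive (edges-exchange {K} {K′} {x} agree)) (+-monoʳ-≤ (edges K′) deg≤))

  edges-strict : ∀ {K K′ x} → AgreeOff x K K′ → ∣ N K x ∣ < ∣ N K′ x ∣ → edges K < edges K′
  edges-strict {K} {K′} {x} agree deg< = +-cancelʳ-< ∣ N K′ x ∣ _ _
    (≤-<-trans (≤-reflexive (edges-exchange {K} {K′} {x} agree)) (+-monoʳ-< (edges K′) deg<))

-- Members of S_q

module _ {n : ℕ} {H : Graph n} where
  open Reachability H

  unreachable-pair : ¬ Connected H → ∃[ u ] ∃[ v ] ¬ Walk H u v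
  unreachable-pair ¬conn with ¬∀⟶∃¬ n _ (λ u → all? (walk? u)) ¬conn
  ... | u , ¬∀v = u , ¬∀⟶∃¬ n _ (walk? u) ¬∀v

  three-components : ∀ {G : Graph n} {q} → InS q G H → q < n →
    Σ (Subset n) λ C₁ → Σ (Subset n) λ C₂ → Σ (Subset n) λ C₃ →
      IsComponent H C₁ × IsComponent H C₂ × IsComponent H C₃ × C₁ ≢ C₂ × C₁ ≢ C₃ × C₂ ≢ C₃
  three-components {q = q} (_ , ¬conn , or₁+or₂≤q) q<n with unreachable-pair ¬conn
  ... | u , v , ¬u⇝v = reach u , reach v , reach w , c , c′ , c″ , C≢C′ , C≢C″ , C′≢C″
    where
    c = reach-isComponent u
    c′ = reach-isComponent v
    C≢C′ : reach u ≢ reach v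
    C≢C′ eq = ¬u⇝v (reach-sound (subst (v ∈_) (sym eq) (root∈component c′)))
    ∣C∪C′∣<n : ∣ reach u ∪ reach v ∣ < n
    ∣C∪C′∣<n = begin-strict
      ∣ reach u ∪ reach v ∣           ≤⟨ ∣p∪q∣≤∣p∣+∣q∣ (reach u) (reach v) ⟩
      ∣ reach u ∣ + ∣ reach v ∣       ≤⟨ two-components≤or₁+or₂ O c c′ C≢C′ ⟩
      or O 1 + or O 2                 ≤⟨ or₁+or₂≤q O ⟩
      q                               <⟨ q<n ⟩
      n                               ∎
      where
      open ≤-Reasoning
      O = ComponentOrder.componentOrder H
    w = proj₁ (∣p∣<n⇒∃∉ _ ∣C∪C′∣<n)
    w∉C∪C′ = proj₂ (∣p∣<n⇒∃∉ _ ∣C∪C′∣<n)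
    c″ = reach-isComponent w
    C≢C″ : reach u ≢ reach w
    C≢C″ eq = w∉C∪C′ (x∈p∪q⁺ (inj₁ (subst (w ∈_) (sym eq) (root∈component c″))))
    C′≢C″ : reach v ≢ reach w
    C′≢C″ eq = w∉C∪C′ (x∈p∪q⁺ (inj₂ (subst (w ∈_) (sym eq) (root∈component c″))))

module _ {n : ℕ} {H H′ : Graph n}
  (to : ∀ {a b} → Walk H a b → Walk H′ a b) (from : ∀ {a b} → Walk H′ a b → Walk H a b) where

  component-transfer : ∀ {C} → IsComponent H C → IsComponent H′ C
  component-transfer (r , c) = r , λ w → mk⇔ (to ∘ Equivalence.to (c w)) (Equivalence.from (c w) ∘ from)

  InS-transfer : ∀ {G : Graph n} {q} → SpanningSubgraph G H′ → InS q G H → InS q G H′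
  InS-transfer H′⊆G (_ , ¬conn , bound) = H′⊆G , (λ conn → ¬conn (λ a b → from (conn a b))) , λ O′ → bound (record
    { s        = s O′
    ; comp     = comp O′
    ; isComp   = λ i → component-transfer′ (isComp O′ i)
    ; distinct = distinct O′
    ; complete = λ C c → complete O′ C (component-transfer c)
    ; sorted   = sorted O′
    })
    where
    component-transfer′ : ∀ {C} → IsComponent H′ C → IsComponent H C
    component-transfer′ (r , c) = r , λ w → mk⇔ (from ∘ Equivalence.to (c w)) (Equivalence.from (c w) ∘ to)

module AddEdge {n : ℕ} (H : Graph n) (u v : Fin n) (u≢v : u ≢ v) where

  Joins : Fin n → Fin n → Set
  Joins a b = (a ≡ u × b ≡ v) ⊎ (a ≡ v × b ≡ u)

  joins? : ∀ a b → Dec (Joins a b)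
  joins? a b = (a ≟ᶠ u ×-dec b ≟ᶠ v) ⊎-dec (a ≟ᶠ v ×-dec b ≟ᶠ u)

  joins-sym : ∀ a b → Joins a b → Joins b a
  joins-sym a b (inj₁ (a≡u , b≡v)) = inj₂ (b≡v , a≡u)
  joins-sym a b (inj₂ (a≡v , b≡u)) = inj₁ (b≡u , a≡v)

  ¬joins-self : ∀ a → ¬ Joins a a
  ¬joins-self a (inj₁ (refl , a≡v)) = u≢v a≡v
  ¬joins-self a (inj₂ (refl , a≡u)) = u≢v (sym a≡u)

  H+uv : Graph n
  H+uv = record
    { adj    = λ a b → adj H a b ∨ does (joins? a b)
    ; sym    = λ a b → cong₂ _∨_ (Graph.sym H a b) (does-⇔ (mk⇔ (joins-sym a b) (joins-sym b a)) (joins? a b) (joins? b a))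
    ; irrefl = λ a → cong₂ _∨_ (Graph.irrefl H a) (dec-false (joins? a a) (¬joins-self a))
    }

  H⊆H+uv : ∀ {a b} → adj H a b ≡ true → adj H+uv a b ≡ true
  H⊆H+uv e rewrite e = refl

  edge-of-H+uv : ∀ {a b} → adj H+uv a b ≡ true → adj H a b ≡ true ⊎ Joins a b
  edge-of-H+uv {a} {b} e with adj H a b
  ... | true  = inj₁ refl
  ... | false = inj₂ (does⇒ (joins? a b) e)

  agree : AgreeOff u H H+uv
  agree a b a≢u b≢u = sym (trans (cong (adj H a b ∨_) (dec-false (joins? a b) ¬joins)) (Bool.∨-identityʳ _))
    where
    ¬joins : ¬ Joins a b
    ¬joins (inj₁ (a≡u , _)) = a≢u a≡u
    ¬joins (inj₂ (_ , b≡u)) = b≢u b≡u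

  edges-H<edges-H+uv : adj H u v ≡ false → edges H < edges H+uv
  edges-H<edges-H+uv ¬uv = edges-strict {K = H} {K′ = H+uv} {x = u} agree (p⊂q⇒∣p∣<∣q∣ (N-⊆ , v , v∈N+ , v∉N))
    where
    N-⊆ : N H u ⊆ N H+uv u
    N-⊆ w∈ = ∈N⁺ H+uv (H⊆H+uv (∈N⁻ H w∈))
    v∈N+ : v ∈ N H+uv u
    v∈N+ = ∈N⁺ H+uv (trans (cong (adj H u v ∨_) (dec-true (joins? u v) (inj₁ (refl , refl)))) (Bool.∨-zeroʳ _))
    v∉N : v ∉ N H u
    v∉N v∈N = contradiction (trans (sym (∈N⁻ H v∈N)) ¬uv) (λ ())

  walk-to-H+uv : ∀ {a b} → Walk H a b → Walk H+uv a b
  walk-to-H+uv = walk-map (λ e → step (H⊆H+uv e) here)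

  walk-from-H+uv : Walk H u v → ∀ {a b} → Walk H+uv a b → Walk H a b
  walk-from-H+uv u⇝v = walk-map edge
    where
    edge : ∀ {a b} → adj H+uv a b ≡ true → Walk H a b
    edge e with edge-of-H+uv e
    ... | inj₁ e′ = step e′ here
    ... | inj₂ (inj₁ (refl , refl)) = u⇝v
    ... | inj₂ (inj₂ (refl , refl)) = walk-reverse H u⇝v

maximal⇒components-induced : ∀ {n} {G H : Graph n} {q : ℕ} → InM q G H →
  ∀ C → IsComponent H C → ∀ u v → u ∈ C → v ∈ C → adj G u v ≡ true → adj H u v ≡ true
maximal⇒components-induced {G = G} {H} {q} (inS , maximal) C c u v u∈C v∈C uv∈G with adj H u v in uv∉H
... | true  = refl
... | false = contradiction (maximal H+uv H+uv∈S) (<⇒≱ (edges-H<edges-H+uv uv∉H))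
  where
  u≢v : u ≢ v
  u≢v refl = contradiction (trans (sym (Graph.irrefl G u)) uv∈G) λ ()
  open AddEdge H u v u≢v
  u⇝v : Walk H u v
  u⇝v = component-walk c u∈C v∈C
  H+uv⊆G : SpanningSubgraph G H+uv
  H+uv⊆G a b e with edge-of-H+uv e
  ... | inj₁ e′ = proj₁ inS a b e′
  ... | inj₂ (inj₁ (refl , refl)) = uv∈G
  ... | inj₂ (inj₂ (refl , refl)) = trans (Graph.sym G v u) uv∈G
  H+uv∈S : InS q G H+uv
  H+uv∈S = InS-transfer walk-to-H+uv (walk-from-H+uv u⇝v) {G} {q} H+uv⊆G inS

-- Members of M_q

module MoveVertex {n : ℕ} (G H : Graph n) {C D : Subset n}
    (c : IsComponent H C) (d : IsComponent H D) (D≢C : D ≢ C) {x : Fin n} (x∈D : x ∈ D) where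

  x∉C : x ∉ C
  x∉C = components-disjoint d c D≢C x∈D

  M : Subset n
  M = N G x ∩ C

  x∉M : x ∉ M
  x∉M x∈M = contradiction (trans (sym (∈N⁻ G (proj₁ (x∈p∩q⁻ _ _ x∈M)))) (Graph.irrefl G x)) λ ()

  adj′ : Fin n → Fin n → Bool
  adj′ a b with a ≟ᶠ x | b ≟ᶠ x
  ... | yes _ | _     = does (b ∈? M)
  ... | no _  | yes _ = does (a ∈? M)
  ... | no _  | no _  = adj H a b

  adj′-from-x : ∀ b → adj′ x b ≡ does (b ∈? M)
  adj′-from-x b with x ≟ᶠ x
  ... | yes _  = refl
  ... | no x≢x = contradiction refl x≢x

  adj′-to-x : ∀ {a} → a ≢ x → adj′ a x ≡ does (a ∈? M)
  adj′-to-x {a} a≢x with a ≟ᶠ x | x ≟ᶠ x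
  ... | yes a≡x | _     = contradiction a≡x a≢x
  ... | no _    | yes _ = refl
  ... | no _    | no x≢x = contradiction refl x≢x

  adj′-off : ∀ {a b} → a ≢ x → b ≢ x → adj′ a b ≡ adj H a b
  adj′-off {a} {b} a≢x b≢x with a ≟ᶠ x | b ≟ᶠ x
  ... | yes a≡x | _       = contradiction a≡x a≢x
  ... | no _    | yes b≡x = contradiction b≡x b≢x
  ... | no _    | no _    = refl

  adj′-sym : ∀ a b → adj′ a b ≡ adj′ b a
  adj′-sym a b = by-cases (a ≟ᶠ x) (b ≟ᶠ x)
    where
    by-cases : Dec (a ≡ x) → Dec (b ≡ x) → adj′ a b ≡ adj′ b a
    by-cases (yes a≡x) (yes b≡x) = cong₂ adj′ (trans a≡x (sym b≡x)) (trans b≡x (sym a≡x))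
    by-cases (yes a≡x) (no b≢x)  = subst (λ a → adj′ a b ≡ adj′ b a) (sym a≡x)
                                     (trans (adj′-from-x b) (sym (adj′-to-x b≢x)))
    by-cases (no a≢x)  (yes b≡x) = subst (λ b → adj′ a b ≡ adj′ b a) (sym b≡x)
                                     (trans (adj′-to-x a≢x) (sym (adj′-from-x a)))
    by-cases (no a≢x)  (no b≢x)  = trans (adj′-off a≢x b≢x) (trans (Graph.sym H a b) (sym (adj′-off b≢x a≢x)))

  adj′-irrefl : ∀ a → adj′ a a ≡ false
  adj′-irrefl a = by-cases (a ≟ᶠ x)
    where
    by-cases : Dec (a ≡ x) → adj′ a a ≡ false
    by-cases (yes a≡x) = subst (λ a → adj′ a a ≡ false) (sym a≡x) (trans (adj′-from-x x) (dec-false (x ∈? M) x∉M))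
    by-cases (no a≢x)  = trans (adj′-off a≢x a≢x) (Graph.irrefl H a)

  H′ : Graph n
  H′ = record { adj = adj′ ; sym = adj′-sym ; irrefl = adj′-irrefl }

  M⊆C : ∀ {b} → b ∈ M → b ∈ C
  M⊆C b∈M = proj₂ (x∈p∩q⁻ _ _ b∈M)

  data H′-Edge (a b : Fin n) : Set where
    from-x : a ≡ x → b ∈ M → H′-Edge a b
    to-x   : b ≡ x → a ∈ M → H′-Edge a b
    old    : a ≢ x → b ≢ x → adj H a b ≡ true → H′-Edge a b

  H′-edge : ∀ {a b} → adj H′ a b ≡ true → H′-Edge a b
  H′-edge {a} {b} e = by-cases (a ≟ᶠ x) (b ≟ᶠ x)
    where
    by-cases : Dec (a ≡ x) → Dec (b ≡ x) → H′-Edge a b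
    by-cases (yes a≡x) _ =
      from-x a≡x (does⇒ (b ∈? M) (trans (sym (adj′-from-x b)) (subst (λ a → adj′ a b ≡ true) a≡x e)))
    by-cases (no a≢x) (yes b≡x) =
      to-x b≡x (does⇒ (a ∈? M) (trans (sym (adj′-to-x a≢x)) (subst (λ b → adj′ a b ≡ true) b≡x e)))
    by-cases (no a≢x) (no b≢x) = old a≢x b≢x (trans (sym (adj′-off a≢x b≢x)) e)

  H′-spanning : SpanningSubgraph G H → SpanningSubgraph G H′
  H′-spanning H⊆G a b e with H′-edge {a} {b} e
  ... | from-x refl b∈M = ∈N⁻ G (proj₁ (x∈p∩q⁻ _ _ b∈M))
  ... | to-x refl a∈M = trans (Graph.sym G a x) (∈N⁻ G (proj₁ (x∈p∩q⁻ _ _ a∈M)))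
  ... | old _ _ e′ = H⊆G a b e′

  edges-H≤edges-H′ : ∣ N H x ∣ ≤ ∣ M ∣ → edges H ≤ edges H′
  edges-H≤edges-H′ deg≤ = edges-mono {K = H} {K′ = H′} {x = x}
    (λ a b a≢x b≢x → sym (adj′-off a≢x b≢x)) (≤-trans deg≤ (p⊆q⇒∣p∣≤∣q∣ M⊆N′))
    where
    M⊆N′ : M ⊆ N H′ x
    M⊆N′ {b} b∈M = ∈N⁺ H′ {x} (trans (adj′-from-x b) (dec-true (b ∈? M) b∈M))

  C⁺ : Subset n
  C⁺ = C ∪ ⁅ x ⁆

  x∈C⁺ : x ∈ C⁺
  x∈C⁺ = x∈p∪q⁺ (inj₂ (x∈⁅x⁆ x))

  C⁺-closed : Closed H′ C⁺
  C⁺-closed {y} {z} y∈C⁺ e with H′-edge {y} {z} e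
  ... | from-x _ z∈M = x∈p∪q⁺ (inj₁ (M⊆C z∈M))
  ... | to-x refl _ = x∈C⁺
  ... | old y≢x _ e′ with x∈p∪q⁻ C ⁅ x ⁆ y∈C⁺
  ...   | inj₁ y∈C = x∈p∪q⁺ (inj₁ (component-closed c y∈C e′))
  ...   | inj₂ y∈⁅x⁆ = contradiction (x∈⁅y⁆⇒x≡y x y∈⁅x⁆) y≢x

  ∣C∣<∣C⁺∣ : ∣ C ∣ < ∣ C⁺ ∣
  ∣C∣<∣C⁺∣ = p⊂q⇒∣p∣<∣q∣ (p⊆p∪q _ , x , x∈C⁺ , x∉C)

  ∣C⁺∣≤∣C∣+1 : ∣ C⁺ ∣ ≤ ∣ C ∣ + 1
  ∣C⁺∣≤∣C∣+1 = ≤-trans (∣p∪q∣≤∣p∣+∣q∣ C ⁅ x ⁆) (≤-reflexive (cong (∣ C ∣ +_) (∣⁅x⁆∣≡1 x)))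

  closed-avoiding : ∀ {S} → x ∉ S → (∀ {y} → y ∈ S → y ∉ C) →
    (∀ {y z} → y ∈ S → adj H y z ≡ true → z ≢ x → z ∈ S) → Closed H′ S
  closed-avoiding x∉S S∩C=∅ closed-off-x {y} {z} y∈S e with H′-edge {y} {z} e
  ... | from-x refl _ = contradiction y∈S x∉S
  ... | to-x _ y∈M = contradiction (M⊆C y∈M) (S∩C=∅ y∈S)
  ... | old _ z≢x e′ = closed-off-x y∈S e′ z≢x

  module _ {y : Fin n} (y∈M : y ∈ M) where

    walk-from-x : ∀ {b} → b ∈ C⁺ → Walk H′ x b
    walk-from-x {b} b∈C⁺ with x∈p∪q⁻ C ⁅ x ⁆ b∈C⁺
    ... | inj₂ b∈⁅x⁆ rewrite x∈⁅y⁆⇒x≡y x b∈⁅x⁆ = here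
    ... | inj₁ b∈C = step x–y (walk-restrict (component-closed c) kept (M⊆C y∈M) (component-walk c (M⊆C y∈M) b∈C))
      where
      x–y : adj H′ x y ≡ true
      x–y = trans (adj′-from-x y) (dec-true (y ∈? M) y∈M)
      ∈C⇒≢x : ∀ {w} → w ∈ C → w ≢ x
      ∈C⇒≢x w∈C refl = x∉C w∈C
      kept : ∀ {u w} → u ∈ C → adj H u w ≡ true → adj H′ u w ≡ true
      kept u∈C e = trans (adj′-off (∈C⇒≢x u∈C) (∈C⇒≢x (component-closed c u∈C e))) e

    ∉component⇒avoids-C : ∀ {A} → IsComponent H′ A → x ∉ A → ∀ {w} → w ∈ A → w ∉ C
    ∉component⇒avoids-C a x∉A w∈A w∈C =
      x∉A (walk-closed H′ (component-closed a) w∈A (walk-reverse H′ (walk-from-x (x∈p∪q⁺ (inj₁ w∈C)))))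

    data SizeBound (A : Subset n) : Set where
      with-x : x ∈ A → ∣ A ∣ ≤ ∣ C ∣ + 1 → SizeBound A
      in-D   : x ∉ A → ∣ A ∣ < ∣ D ∣ → SizeBound A
      in-E   : ∀ {E} → x ∉ A → IsComponent H E → E ≢ C → E ≢ D → ∣ A ∣ ≤ ∣ E ∣ → SizeBound A

    H′-component-bound : ∀ {A} → IsComponent H′ A → SizeBound A
    H′-component-bound {A} a with x ∈? A
    ... | yes x∈A = with-x x∈A (≤-trans (p⊆q⇒∣p∣≤∣q∣ (component-⊆ a C⁺-closed x∈A x∈C⁺)) ∣C⁺∣≤∣C∣+1)
    ... | no x∉A with proj₁ a ∈? D
    ...   | yes r∈D = in-D x∉A (≤-<-trans (p⊆q⇒∣p∣≤∣q∣ A⊆D-x) (x∈p⇒∣p-x∣<∣p∣ x∈D))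
      where
      r∈A = root∈component a
      A⊆D-x : A ⊆ D - x
      A⊆D-x = component-⊆ a
        (closed-avoiding (λ x∈ → x∈p-y⇒x≢y x∈ refl)
          (λ w∈ → components-disjoint d c D≢C (p─q⊆p _ _ w∈))
          (λ w∈ e z≢x → x∈p∧x≢y⇒x∈p-y (component-closed d (p─q⊆p _ _ w∈) e) z≢x))
        r∈A (x∈p∧x≢y⇒x∈p-y r∈D (λ { refl → x∉A r∈A }))
    ...   | no r∉D = in-E x∉A e E≢C E≢D (p⊆q⇒∣p∣≤∣q∣ A⊆E)
      where
      open Reachability H
      r = proj₁ a
      r∈A = root∈component a
      e = reach-isComponent r
      r∈E = root∈component e
      E≢C : reach r ≢ C
      E≢C eq = ∉component⇒avoids-C a x∉A r∈A (subst (r ∈_) eq r∈E)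
      E≢D : reach r ≢ D
      E≢D eq = r∉D (subst (r ∈_) eq r∈E)
      A⊆E : A ⊆ reach r
      A⊆E = component-⊆ a
        (closed-avoiding (components-disjoint d e (E≢D ∘ sym) x∈D) (components-disjoint e c E≢C)
          (λ w∈ e′ _ → component-closed e w∈ e′))
        r∈A r∈E

module MoveIntoLargest {n : ℕ} {G H : Graph n} {q : ℕ} (H⊆G : SpanningSubgraph G H) (q<n : q < n)
  {C D : Subset n} (c : IsComponent H C) (d : IsComponent H D) (D≢C : D ≢ C)
  {x y : Fin n} (x∈D : x ∈ D) (y∈M : y ∈ N G x ∩ C)
  (largest : ∀ {E} → IsComponent H E → ∣ E ∣ ≤ ∣ C ∣) (D+C≤q : ∣ D ∣ + ∣ C ∣ ≤ q)
  (E+C<q : ∀ {E} → IsComponent H E → E ≢ C → E ≢ D → ∣ E ∣ + ∣ C ∣ + 1 ≤ q) where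

  open MoveVertex G H c d D≢C x∈D

  C+1≤q : ∣ C ∣ + 1 ≤ q
  C+1≤q = ≤-trans (≤-reflexive (+-comm ∣ C ∣ 1)) (≤-trans (+-monoˡ-≤ ∣ C ∣ (component-nonempty d)) D+C≤q)

  data Fits (A : Subset n) : Set where
    x-inside  : x ∈ A → ∣ A ∣ ≤ ∣ C ∣ + 1 → Fits A
    x-outside : x ∉ A → ∣ A ∣ ≤ ∣ C ∣ → ∣ A ∣ + ∣ C ∣ + 1 ≤ q → Fits A

  fits : ∀ {A} → IsComponent H′ A → Fits A
  fits a with H′-component-bound y∈M a
  ... | with-x x∈A A≤C+1 = x-inside x∈A A≤C+1
  ... | in-D x∉A A<D = x-outside x∉A (≤-trans (<⇒≤ A<D) (largest d))
          (≤-trans (≤-reflexive (+-comm (_ + ∣ C ∣) 1)) (≤-trans (+-monoˡ-≤ ∣ C ∣ A<D) D+C≤q))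
  ... | in-E x∉A e E≢C E≢D A≤E = x-outside x∉A (≤-trans A≤E (largest e))
          (≤-trans (+-monoˡ-≤ 1 (+-monoˡ-≤ ∣ C ∣ A≤E)) (E+C<q e E≢C E≢D))

  one-component≤q : ∀ {A} → IsComponent H′ A → ∣ A ∣ ≤ q
  one-component≤q a with fits a
  ... | x-inside _ A≤C+1 = ≤-trans A≤C+1 C+1≤q
  ... | x-outside _ _ A+C+1≤q = ≤-trans (≤-trans (m≤m+n _ ∣ C ∣) (m≤m+n _ 1)) A+C+1≤q

  two-components≤q : ∀ {A B} → IsComponent H′ A → IsComponent H′ B → A ≢ B → ∣ A ∣ + ∣ B ∣ ≤ q
  two-components≤q {A} {B} a b A≢B with fits a | fits b
  ... | x-inside x∈A _ | x-inside x∈B _ = contradiction (components-≡ a b x∈A x∈B) A≢B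
  ... | x-inside _ A≤C+1 | x-outside _ _ B+C+1≤q =
    ≤-trans (+-monoˡ-≤ ∣ B ∣ A≤C+1) (≤-trans (≤-reflexive (rearrange ∣ C ∣ ∣ B ∣)) B+C+1≤q)
    where
    rearrange : ∀ c b → c + 1 + b ≡ b + c + 1
    rearrange = solve-∀
  ... | x-outside _ _ A+C+1≤q | x-inside _ B≤C+1 =
    ≤-trans (+-monoʳ-≤ ∣ A ∣ B≤C+1) (≤-trans (≤-reflexive (sym (+-assoc ∣ A ∣ ∣ C ∣ 1))) A+C+1≤q)
  ... | x-outside _ A≤C _ | x-outside _ _ B+C+1≤q =
    ≤-trans (+-monoˡ-≤ ∣ B ∣ A≤C) (≤-trans (≤-reflexive (+-comm ∣ C ∣ ∣ B ∣)) (≤-trans (m≤m+n _ 1) B+C+1≤q))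

  H′-disconnected : ¬ Connected H′
  H′-disconnected conn with ∣p∣<n⇒∃∉ C⁺ (≤-<-trans ∣C⁺∣≤∣C∣+1 (≤-<-trans C+1≤q q<n))
  ... | w , w∉C⁺ = w∉C⁺ (walk-closed H′ C⁺-closed x∈C⁺ (conn x w))

  H′∈S : InS q G H′
  H′∈S = H′-spanning H⊆G , H′-disconnected , or₁+or₂≤-of-components one-component≤q two-components≤q

  C<or₁ : ∀ (O′ : CompOrder H′) → ∣ C ∣ < or O′ 1
  C<or₁ O′ = <-≤-trans ∣C∣<∣C⁺∣ (≤-trans (p⊆q⇒∣p∣≤∣q∣ C⁺⊆reach′) (component≤or₁ O′ (reach′-isComponent x)))
    where
    open Reachability H′ renaming (reach to reach′; reach-complete to reach′-complete; reach-isComponent to reach′-isComponent)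
    C⁺⊆reach′ : C⁺ ⊆ reach′ x
    C⁺⊆reach′ b∈C⁺ = reach′-complete (walk-from-x y∈M b∈C⁺)

module _ {n : ℕ} {G H : Graph n} {q : ℕ} (q<n : q < n) (H∈M : InM q G H)
  (or₁-maximal : ∀ (H′ : Graph n) → InM q G H′ → ∀ (O : CompOrder H) (O′ : CompOrder H′) → or O′ 1 ≤ or O 1)
  (O : CompOrder H) (or₁+or₃≢q : or O 1 + or O 3 ≢ q)
  {C₁ : Subset n} (c₁ : IsComponent H C₁) (∣C₁∣≡or₁ : ∣ C₁ ∣ ≡ or O 1) where

  private
    H⊆G : SpanningSubgraph G H
    H⊆G = proj₁ (proj₁ H∈M)
    or₁+or₂≤q : or O 1 + or O 2 ≤ q
    or₁+or₂≤q = proj₂ (proj₂ (proj₁ H∈M)) O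

  largest : ∀ {E} → IsComponent H E → ∣ E ∣ ≤ ∣ C₁ ∣
  largest {E} e = subst (∣ E ∣ ≤_) (sym ∣C₁∣≡or₁) (component≤or₁ O e)

  no-improving-move : ∀ {D x y} → IsComponent H D → D ≢ C₁ → x ∈ D → y ∈ N G x ∩ C₁ →
    ∣ N H x ∣ ≤ ∣ N G x ∩ C₁ ∣ → ∣ D ∣ ≤ or O 2 →
    (∀ {E} → IsComponent H E → E ≢ C₁ → E ≢ D → ∣ E ∣ ≤ or O 3) → ⊥
  no-improving-move {D} d D≢C₁ x∈D y∈M deg≤ D≤or₂ E≤or₃ =
    <-irrefl ∣C₁∣≡or₁ (<-≤-trans (C<or₁ O′) (or₁-maximal H′ H′∈M O O′))
    where
    D+C₁≤q : ∣ D ∣ + ∣ C₁ ∣ ≤ q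
    D+C₁≤q = ≤-trans (+-mono-≤ D≤or₂ (≤-reflexive ∣C₁∣≡or₁)) (≤-trans (≤-reflexive (+-comm (or O 2) (or O 1))) or₁+or₂≤q)
    or₁+or₃<q : or O 1 + or O 3 < q
    or₁+or₃<q = ≤∧≢⇒< (≤-trans (+-monoʳ-≤ (or O 1) (or₃≤or₂ O)) or₁+or₂≤q) or₁+or₃≢q
    E+C₁<q : ∀ {E} → IsComponent H E → E ≢ C₁ → E ≢ D → ∣ E ∣ + ∣ C₁ ∣ + 1 ≤ q
    E+C₁<q {E} e E≢C₁ E≢D = ≤-trans (≤-reflexive (trans (+-comm (∣ E ∣ + ∣ C₁ ∣) 1) (cong suc (+-comm ∣ E ∣ ∣ C₁ ∣))))
      (≤-trans (s≤s (+-mono-≤ (≤-reflexive ∣C₁∣≡or₁) (E≤or₃ e E≢C₁ E≢D))) or₁+or₃<q)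
    open MoveVertex G H c₁ d D≢C₁ x∈D using (H′; edges-H≤edges-H′)
    open MoveIntoLargest H⊆G q<n c₁ d D≢C₁ x∈D y∈M largest D+C₁≤q E+C₁<q using (H′∈S; C<or₁)
    O′ = ComponentOrder.componentOrder H′
    H′∈M : InM q G H′
    H′∈M = H′∈S , λ K K∈S → ≤-trans (proj₂ H∈M K K∈S) (edges-H≤edges-H′ deg≤)

  module _ (G-conn : Connected G) {C₂ : Subset n} (c₂ : IsComponent H C₂) (C₁≢C₂ : C₁ ≢ C₂)
    (∣C₂∣≡or₂ : ∣ C₂ ∣ ≡ or O 2) where

    no-vertex-of-C₂-prefers-C₁ : ∀ {u} → u ∈ C₂ → ∣ N H u ∣ ≤ ∣ N G u ∩ C₁ ∣ → ⊥
    no-vertex-of-C₂-prefers-C₁ {u} u∈C₂ deg≤ with nonempty? (N G u ∩ C₁)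
    ... | yes (y , y∈M) = no-improving-move c₂ (C₁≢C₂ ∘ sym) u∈C₂ y∈M deg≤ (≤-reflexive ∣C₂∣≡or₂) E≤or₃
      where
      E≤or₃ : ∀ {E} → IsComponent H E → E ≢ C₁ → E ≢ C₂ → ∣ E ∣ ≤ or O 3
      E≤or₃ {E} e E≢C₁ E≢C₂ = component≤or₃ O e c₁ c₂ E≢C₁ E≢C₂ C₁≢C₂ (largest e)
        (subst (∣ E ∣ ≤_) (sym ∣C₂∣≡or₂) (component≤or₂ O e c₁ E≢C₁ (largest e)))
    -- u has no neighbour at all, so every component but C₁ is a single vertex, and a vertex z
    -- next to C₁ in G can be moved instead.
    ... | no empty = no-improving-move d D≢C₁ z∈D y∈M deg≤′ D≤or₂ E≤or₃
      where
      open Reachability H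
      ∣N∣≡0 : ∣ N H u ∣ ≡ 0
      ∣N∣≡0 = n≤0⇒n≡0 (≤-trans deg≤ (≤-reflexive (trans (cong ∣_∣ (Empty-unique empty)) (∣⊥∣≡0 n))))
      or₂≤1 : or O 2 ≤ 1
      or₂≤1 = subst (_≤ 1) ∣C₂∣≡or₂ (isolated-component ∣N∣≡0 c₂ u∈C₂)
      boundary = walk-exit G (root∈component c₁) (components-disjoint c₂ c₁ (C₁≢C₂ ∘ sym) u∈C₂) (G-conn _ u)
      y = proj₁ boundary
      z = proj₁ (proj₂ boundary)
      y∈C₁ = proj₁ (proj₂ (proj₂ boundary))
      z∉C₁ = proj₁ (proj₂ (proj₂ (proj₂ boundary)))
      y–z = proj₂ (proj₂ (proj₂ (proj₂ boundary)))
      d = reach-isComponent z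
      z∈D = root∈component d
      D≢C₁ : reach z ≢ C₁
      D≢C₁ eq = z∉C₁ (subst (z ∈_) eq z∈D)
      D≤or₂ : ∣ reach z ∣ ≤ or O 2
      D≤or₂ = component≤or₂ O d c₁ D≢C₁ (largest d)
      y∈M : y ∈ N G z ∩ C₁
      y∈M = x∈p∩q⁺ (∈N⁺ G (trans (Graph.sym G z y) y–z) , y∈C₁)
      deg≤′ : ∣ N H z ∣ ≤ ∣ N G z ∩ C₁ ∣
      deg≤′ = ≤-trans (≤-pred (<-≤-trans (degree<component d z∈D) (≤-trans D≤or₂ or₂≤1))) z≤n
      E≤or₃ : ∀ {E} → IsComponent H E → E ≢ C₁ → E ≢ reach z → ∣ E ∣ ≤ or O 3
      E≤or₃ e E≢C₁ E≢D = component≤or₃ O e c₁ d E≢C₁ E≢D (D≢C₁ ∘ sym) (largest e)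
        (≤-trans (component≤or₂ O e c₁ E≢C₁ (largest e)) (≤-trans or₂≤1 (component-nonempty d)))

    second-component-dominates : ∀ u → u ∈ C₂ → ∣ N G u ∩ C₁ ∣ < ∣ N G u ∩ C₂ ∣
    second-component-dominates u u∈C₂ with ∣ N G u ∩ C₁ ∣ <? ∣ N G u ∩ C₂ ∣
    ... | yes dominates = dominates
    ... | no ¬dominates = ⊥-elim (no-vertex-of-C₂-prefers-C₁ u∈C₂ (≤-trans (p⊆q⇒∣p∣≤∣q∣ N⊆) (≮⇒≥ ¬dominates)))
      where
      N⊆ : N H u ⊆ N G u ∩ C₂
      N⊆ b∈ = x∈p∩q⁺ (∈N⁺ G (H⊆G _ _ (∈N⁻ H b∈)) , component-closed c₂ u∈C₂ (∈N⁻ H b∈))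

or₁+or₃≡q⊎second-component-dominates : ∀ {n} {G H : Graph n} {q} → Connected G → q < n → InM q G H →
  (∀ (H′ : Graph n) → InM q G H′ → ∀ (O : CompOrder H) (O′ : CompOrder H′) → or O′ 1 ≤ or O 1) →
  ∀ (O : CompOrder H) →
    (or O 1 + or O 3 ≡ q)
    ⊎ (∀ (C₁ C₂ : Subset n) → IsComponent H C₁ → IsComponent H C₂ → C₁ ≢ C₂ →
         ∣ C₁ ∣ ≡ or O 1 → ∣ C₂ ∣ ≡ or O 2 →
         ∀ (u : Fin n) → u ∈ C₂ → ∣ N G u ∩ C₁ ∣ < ∣ N G u ∩ C₂ ∣)
or₁+or₃≡q⊎second-component-dominates {q = q} G-conn q<n H∈M or₁-maximal O with or O 1 + or O 3 ≟ q
... | yes or₁+or₃≡q = inj₁ or₁+or₃≡q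
... | no or₁+or₃≢q = inj₂ λ C₁ C₂ c₁ c₂ C₁≢C₂ ∣C₁∣≡or₁ ∣C₂∣≡or₂ →
  second-component-dominates q<n H∈M or₁-maximal O or₁+or₃≢q c₁ ∣C₁∣≡or₁ G-conn c₂ C₁≢C₂ ∣C₂∣≡or₂

lemma3p4 : ∀ {n : ℕ} (G : Graph n) (q : ℕ) → Connected G → 3 ≤ n → 2 ≤ q → q ≤ n ∸ 1 →
    (∀ (H : Graph n) → InS q G H →
      Σ (Subset n) λ C₁ → Σ (Subset n) λ C₂ → Σ (Subset n) λ C₃ →
        IsComponent H C₁ × IsComponent H C₂ × IsComponent H C₃ ×
        C₁ ≢ C₂ × C₁ ≢ C₃ × C₂ ≢ C₃)
    × (∀ (H : Graph n) → InM q G H →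
        (∀ (C : Subset n) → IsComponent H C → ∀ (u v : Fin n) → u ∈ C → v ∈ C →
           adj G u v ≡ true → adj H u v ≡ true)
        × ((∀ (H' : Graph n) → InM q G H' → ∀ (O : CompOrder H) (O' : CompOrder H') →
              or O' 1 ≤ or O 1) →
           ∀ (O : CompOrder H) →
             (or O 1 + or O 3 ≡ q)
             ⊎ (∀ (C₁ C₂ : Subset n) → IsComponent H C₁ → IsComponent H C₂ → C₁ ≢ C₂ →
                  ∣ C₁ ∣ ≡ or O 1 → ∣ C₂ ∣ ≡ or O 2 →
                  ∀ (u : Fin n) → u ∈ C₂ → ∣ N G u ∩ C₁ ∣ < ∣ N G u ∩ C₂ ∣)))
lemma3p4 G q G-conn (s≤s _) _ q≤n-1 =
  (λ H H∈S → three-components {H = H} {G = G} H∈S q<n) ,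
  λ H H∈M → maximal⇒components-induced {G = G} {H} {q} H∈M ,
            or₁+or₃≡q⊎second-component-dominates {G = G} {H} {q} G-conn q<n H∈M
  where
  q<n = s≤s q≤n-1
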